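{- Let $\mathbb{F}_4=\{0,1,\alpha,\alpha^2\}$ with $\alpha^2=\alpha+1$, $V=\mathbb{F}_4^{\,5}$, let $L$ be the line spanned by $(0,1,1,1,1)$ and $(1,0,1,\alpha,\alpha^2)$, and let $L_1,\dots,L_6$ be the six simplex lines which intersect every $H_j\cap C_j$ ($j=1,\dots,5$) in a point distinct from $P_j=L\cap C_j$, where $H_1: x_2+x_3+x_4+x_5=0$, $H_2: x_1+x_3+\alpha^2x_4+\alpha x_5=0$, $H_3: x_1+x_2+\alpha x_4+\alpha^2x_5=0$, $H_4: x_1+\alpha^2x_2+\alpha x_3+x_5=0$, $H_5: x_1+\alpha x_2+\alpha^2x_3+x_4=0$. Any two distinct $L_i,L_j$ are disjoint, so they span a hyperplane $S_{ij}$. Then $S_{ij}$ does not contain any $L_k$ with $k\ne i,j$.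
   Context: $C_j=\{x\in V:x_j=0\}$. A vector of $V$ is a simplex vector if precisely one of its coordinates is zero. A point is a $1$-dimensional subspace; a simplex line is a $2$-dimensional subspace all of whose non-zero vectors are simplex vectors. Two lines are disjoint if their intersection is $0$. -}

module Defs where

open import Data.Fin using (Fin; zero; suc)
open import Data.Product using (Σ; ∃; _×_; _,_)
open import Data.Empty using (⊥)
open import Relation.Nullary using (¬_)
open import Relation.Binary.PropositionalEquality using (_≡_)

data F4 : Set where
  𝟘 𝟙 α α² : F4

infixl 6 _⊕_
infixl 7 _⊗_

_⊕_ : F4 → F4 → F4
𝟘  ⊕ y  = y
x  ⊕ 𝟘  = x
𝟙  ⊕ 𝟙  = 𝟘
𝟙  ⊕ α  = α²
𝟙  ⊕ α² = α
α  ⊕ 𝟙  = α²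
α  ⊕ α  = 𝟘
α  ⊕ α² = 𝟙
α² ⊕ 𝟙  = α
α² ⊕ α  = 𝟙
α² ⊕ α² = 𝟘

_⊗_ : F4 → F4 → F4
𝟘  ⊗ y  = 𝟘
x  ⊗ 𝟘  = 𝟘
𝟙  ⊗ y  = y
x  ⊗ 𝟙  = x
α  ⊗ α  = α²
α  ⊗ α² = 𝟙
α² ⊗ α  = 𝟙
α² ⊗ α² = α

-- V = F4^5, vectors as functions on the coordinate set Fin 5
-- (coordinate j of the paper, j = 1..5, is index j-1 here).
V : Set
V = Fin 5 → F4

_+ᵥ_ : V → V → V
(x +ᵥ y) i = x i ⊕ y i

_·_ : F4 → V → V
(c · x) i = c ⊗ x i

_≈_ : V → V → Set
x ≈ y = ∀ i → x i ≡ y i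

IsZero : V → Set
IsZero x = ∀ i → x i ≡ 𝟘

C : Fin 5 → V → Set
C j x = x j ≡ 𝟘

SimplexVector : V → Set
SimplexVector x = Σ (Fin 5) λ j → (x j ≡ 𝟘) × (∀ k → x k ≡ 𝟘 → k ≡ j)

Subspace : Set₁
Subspace = V → Set

Span₂ : V → V → Subspace
Span₂ u v x = Σ F4 λ a → Σ F4 λ b → x ≈ ((a · u) +ᵥ (b · v))

Span₄ : V → V → V → V → Subspace
Span₄ u v w z x = Σ F4 λ a → Σ F4 λ b → Σ F4 λ c → Σ F4 λ d →
  x ≈ ((((a · u) +ᵥ (b · v)) +ᵥ (c · w)) +ᵥ (d · z))

Span₁ : V → Subspace
Span₁ u x = Σ F4 λ c → x ≈ (c · u)

Independent₂ : V → V → Set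
Independent₂ u v = ∀ a b → IsZero ((a · u) +ᵥ (b · v)) → (a ≡ 𝟘) × (b ≡ 𝟘)

SameSubspace : Subspace → Subspace → Set
SameSubspace S T = ∀ x → (S x → T x) × (T x → S x)

IsPoint : Subspace → Set
IsPoint S = Σ V λ u → ¬ IsZero u × SameSubspace S (Span₁ u)

SimplexLine : V → V → Set
SimplexLine u v = Independent₂ u v ×
  (∀ x → Span₂ u v x → ¬ IsZero x → SimplexVector x)

_∩_ : Subspace → Subspace → Subspace
(S ∩ T) x = S x × T x

Disjoint : Subspace → Subspace → Set
Disjoint S T = ∀ x → S x → T x → IsZero x

dot : V → V → F4
dot h x = h zero ⊗ x zero ⊕ h (suc zero) ⊗ x (suc zero)
        ⊕ h (suc (suc zero)) ⊗ x (suc (suc zero))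
        ⊕ h (suc (suc (suc zero))) ⊗ x (suc (suc (suc zero)))
        ⊕ h (suc (suc (suc (suc zero)))) ⊗ x (suc (suc (suc (suc zero))))

vec : F4 → F4 → F4 → F4 → F4 → V
vec a b c d e zero = a
vec a b c d e (suc zero) = b
vec a b c d e (suc (suc zero)) = c
vec a b c d e (suc (suc (suc zero))) = d
vec a b c d e (suc (suc (suc (suc zero)))) = e

hcoef : Fin 5 → V
hcoef zero = vec 𝟘 𝟙 𝟙 𝟙 𝟙
hcoef (suc zero) = vec 𝟙 𝟘 𝟙 α² α
hcoef (suc (suc zero)) = vec 𝟙 𝟙 𝟘 α α²
hcoef (suc (suc (suc zero))) = vec 𝟙 α² α 𝟘 𝟙
hcoef (suc (suc (suc (suc zero)))) = vec 𝟙 α α² 𝟙 𝟘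

H : Fin 5 → Subspace
H j x = dot (hcoef j) x ≡ 𝟘

L : Subspace
L = Span₂ (vec 𝟘 𝟙 𝟙 𝟙 𝟙) (vec 𝟙 𝟘 𝟙 α α²)

P : Fin 5 → Subspace
P j = L ∩ C j

-- the line spanned by u, v is one of the L_i's: a simplex line meeting every
-- H_j ∩ C_j in a point distinct from P_j
Good : V → V → Set
Good u v = SimplexLine u v ×
  (∀ j → IsPoint (Span₂ u v ∩ (H j ∩ C j))
       × ¬ SameSubspace (Span₂ u v ∩ (H j ∩ C j)) (P j))

-- A line L_i as in the statement meets C₁ and C₂ in simplex points, which can therefore be scaled to
-- vectors (0,1,*,*,*) and (1,0,*,*,*); these two span L_i. Running through all 4⁶ choices of the
-- starred entries shows that only seven lines are simplex lines meeting every H_j ∩ C_j outside 0: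
-- the line L and L₁, …, L₆. For these seven lines both claims are finite computations: two distinct
-- ones meet only in 0, and for distinct i, j, k the hyperplane spanned by L_i and L_j misses a basis
-- vector of L_k.

module Submission where

open import Defs
open import Data.Empty using (⊥-elim)
open import Data.Fin using (Fin)
open import Data.Fin.Patterns using (0F; 1F; 2F; 3F; 4F; 5F; 6F)
import Data.Fin.Properties as Fin
open import Data.List using (List; []; _∷_)
open import Data.List.Membership.Propositional using (_∈_; lose)
open import Data.List.Relation.Unary.All as All using ()
open import Data.List.Relation.Unary.Any as Any using (here; there)
open import Data.Product using (Σ; ∃; ∃₂; _×_; _,_; proj₁; proj₂)
open import Relation.Binary.Definitions using (DecidableEquality; _Respects_)
open import Relation.Binary.PropositionalEquality
  using (_≡_; _≢_; refl; sym; trans; cong; cong₂; module ≡-Reasoning)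
open import Relation.Nullary using (¬_; Dec; yes; no)
open import Relation.Nullary.Decidable using (map′; from-yes; ¬?; _×-dec_; _→-dec_)
open import Relation.Unary using (Decidable)

infix 4 _≟_
_≟_ : DecidableEquality F4
𝟘  ≟ 𝟘  = yes refl
𝟘  ≟ 𝟙  = no λ ()
𝟘  ≟ α  = no λ ()
𝟘  ≟ α² = no λ ()
𝟙  ≟ 𝟘  = no λ ()
𝟙  ≟ 𝟙  = yes refl
𝟙  ≟ α  = no λ ()
𝟙  ≟ α² = no λ ()
α  ≟ 𝟘  = no λ ()
α  ≟ 𝟙  = no λ ()
α  ≟ α  = yes refl
α  ≟ α² = no λ ()
α² ≟ 𝟘  = no λ ()
α² ≟ 𝟙  = no λ ()
α² ≟ α  = no λ ()
α² ≟ α² = yes refl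

elements : List F4
elements = 𝟘 ∷ 𝟙 ∷ α ∷ α² ∷ []

∈-elements : ∀ x → x ∈ elements
∈-elements 𝟘  = here refl
∈-elements 𝟙  = there (here refl)
∈-elements α  = there (there (here refl))
∈-elements α² = there (there (there (here refl)))

∀? : {P : F4 → Set} → Decidable P → Dec (∀ x → P x)
∀? P? = map′ (λ all x → All.lookup all (∈-elements x)) (λ h → All.tabulate λ {x} _ → h x)
             (All.all? P? elements)

∃? : {P : F4 → Set} → Decidable P → Dec (∃ P)
∃? P? = map′ Any.satisfied (λ (x , px) → lose (∈-elements x) px) (Any.any? P? elements)

-- Identities proved by enumeration are opaque, so that the type checker never unfolds the enumeration.
opaque
  ⊕-identityʳ : ∀ x → x ⊕ 𝟘 ≡ x
  ⊕-identityʳ = from-yes (∀? λ x → x ⊕ 𝟘 ≟ x)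

  ⊕-assoc : ∀ x y z → (x ⊕ y) ⊕ z ≡ x ⊕ (y ⊕ z)
  ⊕-assoc = from-yes (∀? λ x → ∀? λ y → ∀? λ z → (x ⊕ y) ⊕ z ≟ x ⊕ (y ⊕ z))

  ⊕-interchange : ∀ w x y z → (w ⊕ x) ⊕ (y ⊕ z) ≡ (w ⊕ y) ⊕ (x ⊕ z)
  ⊕-interchange = from-yes (∀? λ w → ∀? λ x → ∀? λ y → ∀? λ z →
    (w ⊕ x) ⊕ (y ⊕ z) ≟ (w ⊕ y) ⊕ (x ⊕ z))

  ⊗-identityˡ : ∀ x → 𝟙 ⊗ x ≡ x
  ⊗-identityˡ = from-yes (∀? λ x → 𝟙 ⊗ x ≟ x)

  ⊗-zeroʳ : ∀ x → x ⊗ 𝟘 ≡ 𝟘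
  ⊗-zeroʳ = from-yes (∀? λ x → x ⊗ 𝟘 ≟ 𝟘)

  ⊗-assoc : ∀ x y z → (x ⊗ y) ⊗ z ≡ x ⊗ (y ⊗ z)
  ⊗-assoc = from-yes (∀? λ x → ∀? λ y → ∀? λ z → (x ⊗ y) ⊗ z ≟ x ⊗ (y ⊗ z))

  ⊗-distribˡ-⊕ : ∀ x y z → x ⊗ (y ⊕ z) ≡ x ⊗ y ⊕ x ⊗ z
  ⊗-distribˡ-⊕ = from-yes (∀? λ x → ∀? λ y → ∀? λ z → x ⊗ (y ⊕ z) ≟ x ⊗ y ⊕ x ⊗ z)

  ⊗-distribʳ-⊕ : ∀ x y z → (y ⊕ z) ⊗ x ≡ y ⊗ x ⊕ z ⊗ x
  ⊗-distribʳ-⊕ = from-yes (∀? λ x → ∀? λ y → ∀? λ z → (y ⊕ z) ⊗ x ≟ y ⊗ x ⊕ z ⊗ x)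

  pivotˡ : ∀ a b → a ⊗ 𝟙 ⊕ b ⊗ 𝟘 ≡ a
  pivotˡ = from-yes (∀? λ a → ∀? λ b → a ⊗ 𝟙 ⊕ b ⊗ 𝟘 ≟ a)

  pivotʳ : ∀ a b → a ⊗ 𝟘 ⊕ b ⊗ 𝟙 ≡ b
  pivotʳ = from-yes (∀? λ a → ∀? λ b → a ⊗ 𝟘 ⊕ b ⊗ 𝟙 ≟ b)

  -- Cramer's rule for a 2 × 2 system; in characteristic 2 the determinant is a d + b c.
  cramerˡ : ∀ a b c d s t → d ⊗ (a ⊗ s ⊕ b ⊗ t) ⊕ b ⊗ (c ⊗ s ⊕ d ⊗ t) ≡ (a ⊗ d ⊕ b ⊗ c) ⊗ s
  cramerˡ = from-yes (∀? λ a → ∀? λ b → ∀? λ c → ∀? λ d → ∀? λ s → ∀? λ t →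
    d ⊗ (a ⊗ s ⊕ b ⊗ t) ⊕ b ⊗ (c ⊗ s ⊕ d ⊗ t) ≟ (a ⊗ d ⊕ b ⊗ c) ⊗ s)

  cramerʳ : ∀ a b c d s t → c ⊗ (a ⊗ s ⊕ b ⊗ t) ⊕ a ⊗ (c ⊗ s ⊕ d ⊗ t) ≡ (a ⊗ d ⊕ b ⊗ c) ⊗ t
  cramerʳ = from-yes (∀? λ a → ∀? λ b → ∀? λ c → ∀? λ d → ∀? λ s → ∀? λ t →
    c ⊗ (a ⊗ s ⊕ b ⊗ t) ⊕ a ⊗ (c ⊗ s ⊕ d ⊗ t) ≟ (a ⊗ d ⊕ b ⊗ c) ⊗ t)

infix 9 _⁻¹
_⁻¹ : F4 → F4
𝟘 ⁻¹  = 𝟘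
𝟙 ⁻¹  = 𝟙
α ⁻¹  = α²
α² ⁻¹ = α

⁻¹-inverseˡ : ∀ x → x ≢ 𝟘 → x ⁻¹ ⊗ x ≡ 𝟙
⁻¹-inverseˡ 𝟘  x≢0 = ⊥-elim (x≢0 refl)
⁻¹-inverseˡ 𝟙  _ = refl
⁻¹-inverseˡ α  _ = refl
⁻¹-inverseˡ α² _ = refl

⁻¹-cancelˡ : ∀ {x} → x ≢ 𝟘 → ∀ y → x ⁻¹ ⊗ (x ⊗ y) ≡ y
⁻¹-cancelˡ {x} x≢0 y = begin
  x ⁻¹ ⊗ (x ⊗ y)  ≡⟨ sym (⊗-assoc (x ⁻¹) x y) ⟩
  (x ⁻¹ ⊗ x) ⊗ y  ≡⟨ cong (_⊗ y) (⁻¹-inverseˡ x x≢0) ⟩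
  𝟙 ⊗ y           ≡⟨ ⊗-identityˡ y ⟩
  y               ∎
  where open ≡-Reasoning

⊗-distribˡ-comb : ∀ c a s b t → c ⊗ (a ⊗ s ⊕ b ⊗ t) ≡ (c ⊗ a) ⊗ s ⊕ (c ⊗ b) ⊗ t
⊗-distribˡ-comb c a s b t = begin
  c ⊗ (a ⊗ s ⊕ b ⊗ t)        ≡⟨ ⊗-distribˡ-⊕ c (a ⊗ s) (b ⊗ t) ⟩
  c ⊗ (a ⊗ s) ⊕ c ⊗ (b ⊗ t)  ≡⟨ sym (cong₂ _⊕_ (⊗-assoc c a s) (⊗-assoc c b t)) ⟩
  (c ⊗ a) ⊗ s ⊕ (c ⊗ b) ⊗ t  ∎
  where open ≡-Reasoning

comb-of-combs : ∀ a b c d c′ d′ s t →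
  a ⊗ (c ⊗ s ⊕ d ⊗ t) ⊕ b ⊗ (c′ ⊗ s ⊕ d′ ⊗ t) ≡ (a ⊗ c ⊕ b ⊗ c′) ⊗ s ⊕ (a ⊗ d ⊕ b ⊗ d′) ⊗ t
comb-of-combs a b c d c′ d′ s t = begin
  a ⊗ (c ⊗ s ⊕ d ⊗ t) ⊕ b ⊗ (c′ ⊗ s ⊕ d′ ⊗ t)
    ≡⟨ cong₂ _⊕_ (⊗-distribˡ-comb a c s d t) (⊗-distribˡ-comb b c′ s d′ t) ⟩
  ((a ⊗ c) ⊗ s ⊕ (a ⊗ d) ⊗ t) ⊕ ((b ⊗ c′) ⊗ s ⊕ (b ⊗ d′) ⊗ t)
    ≡⟨ ⊕-interchange ((a ⊗ c) ⊗ s) ((a ⊗ d) ⊗ t) ((b ⊗ c′) ⊗ s) ((b ⊗ d′) ⊗ t) ⟩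
  ((a ⊗ c) ⊗ s ⊕ (b ⊗ c′) ⊗ s) ⊕ ((a ⊗ d) ⊗ t ⊕ (b ⊗ d′) ⊗ t)
    ≡⟨ sym (cong₂ _⊕_ (⊗-distribʳ-⊕ s (a ⊗ c) (b ⊗ c′)) (⊗-distribʳ-⊕ t (a ⊗ d) (b ⊗ d′))) ⟩
  (a ⊗ c ⊕ b ⊗ c′) ⊗ s ⊕ (a ⊗ d ⊕ b ⊗ d′) ⊗ t
    ∎
  where open ≡-Reasoning

comb : V → V → F4 → F4 → V
comb u v a b = (a · u) +ᵥ (b · v)

≈-sym : ∀ {x y} → x ≈ y → y ≈ x
≈-sym x≈y i = sym (x≈y i)

≈-trans : ∀ {x y z} → x ≈ y → y ≈ z → x ≈ z
≈-trans x≈y y≈z i = trans (x≈y i) (y≈z i)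

infix 4 _≈?_
_≈?_ : (x y : V) → Dec (x ≈ y)
x ≈? y = Fin.all? λ i → x i ≟ y i

IsZero? : (x : V) → Dec (IsZero x)
IsZero? x = Fin.all? λ i → x i ≟ 𝟘

SimplexVector? : (x : V) → Dec (SimplexVector x)
SimplexVector? x = Fin.any? λ j → x j ≟ 𝟘 ×-dec Fin.all? λ k → x k ≟ 𝟘 →-dec k Fin.≟ j

IsZero-resp : IsZero Respects _≈_
IsZero-resp x≈y x≡0 i = trans (sym (x≈y i)) (x≡0 i)

C-resp : ∀ j → C j Respects _≈_
C-resp j x≈y xj≡0 = trans (sym (x≈y j)) xj≡0

dot-cong : ∀ h {x y} → x ≈ y → dot h x ≡ dot h y
dot-cong h x≈y rewrite x≈y 0F | x≈y 1F | x≈y 2F | x≈y 3F | x≈y 4F = refl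

H-resp : ∀ j → H j Respects _≈_
H-resp j x≈y hx = trans (sym (dot-cong (hcoef j) x≈y)) hx

simplex-unique-zero : ∀ {x i j} → SimplexVector x → x i ≡ 𝟘 → x j ≡ 𝟘 → i ≡ j
simplex-unique-zero (_ , _ , only) xi≡0 xj≡0 = trans (only _ xi≡0) (sym (only _ xj≡0))

Span₂-resp : ∀ {u v} → Span₂ u v Respects _≈_
Span₂-resp x≈y (a , b , x≈) = a , b , ≈-trans (≈-sym x≈y) x≈

Span₂-left : ∀ u v → Span₂ u v u
Span₂-left u v = 𝟙 , 𝟘 , λ i → sym (trans (⊕-identityʳ (𝟙 ⊗ u i)) (⊗-identityˡ (u i)))

Span₂-right : ∀ u v → Span₂ u v v
Span₂-right u v = 𝟘 , 𝟙 , λ i → sym (⊗-identityˡ (v i))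

Span₂-scale : ∀ {u v x} c → Span₂ u v x → Span₂ u v (c · x)
Span₂-scale {u} {v} c (a , b , x≈) =
  c ⊗ a , c ⊗ b , λ i → trans (cong (c ⊗_) (x≈ i)) (⊗-distribˡ-comb c a (u i) b (v i))

Span₂-unscale : ∀ {u v x c} → c ≢ 𝟘 → Span₂ u v (c · x) → Span₂ u v x
Span₂-unscale {c = c} c≢0 cx∈ = Span₂-resp (λ i → ⁻¹-cancelˡ c≢0 _) (Span₂-scale (c ⁻¹) cx∈)

Span₂-⊆ : ∀ {e f p q x} → Span₂ e f p → Span₂ e f q → Span₂ p q x → Span₂ e f x
Span₂-⊆ {e} {f} (c , d , p≈) (c′ , d′ , q≈) (a , b , x≈) =
  a ⊗ c ⊕ b ⊗ c′ , a ⊗ d ⊕ b ⊗ d′ , λ i →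
    trans (x≈ i) (trans (cong₂ (λ s t → a ⊗ s ⊕ b ⊗ t) (p≈ i) (q≈ i))
                        (comb-of-combs a b c d c′ d′ (e i) (f i)))

Span₂-same : ∀ {u v p q} → Span₂ u v p → Span₂ u v q → Span₂ p q u → Span₂ p q v →
  SameSubspace (Span₂ u v) (Span₂ p q)
Span₂-same p∈ q∈ u∈ v∈ x = Span₂-⊆ u∈ v∈ , Span₂-⊆ p∈ q∈

Span₂-cong : ∀ {u v p q} → u ≈ p → v ≈ q → SameSubspace (Span₂ u v) (Span₂ p q)
Span₂-cong u≈p v≈q = Span₂-same (Span₂-resp u≈p (Span₂-left _ _)) (Span₂-resp v≈q (Span₂-right _ _))
  (Span₂-resp (≈-sym u≈p) (Span₂-left _ _)) (Span₂-resp (≈-sym v≈q) (Span₂-right _ _))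

independent⇒nonzero : ∀ {p q} → Independent₂ p q → ¬ IsZero p
independent⇒nonzero {p} ind p≡0 = 𝟙≢𝟘 (proj₁ (ind 𝟙 𝟘 λ i → trans (⊕-identityʳ (𝟙 ⊗ p i)) (trans (⊗-identityˡ (p i)) (p≡0 i))))
  where
  𝟙≢𝟘 : 𝟙 ≢ 𝟘
  𝟙≢𝟘 ()

independent-spans : ∀ {u v p q} → Span₂ u v p → Span₂ u v q → Independent₂ p q →
  Span₂ p q u × Span₂ p q v
independent-spans {u} {v} {p} {q} (a , b , p≈) (c , d , q≈) ind = by-determinant (δ ≟ 𝟘)
  where
  δ : F4
  δ = a ⊗ d ⊕ b ⊗ c
  δu : comb p q d b ≈ (δ · u)
  δu i = trans (cong₂ (λ s t → d ⊗ s ⊕ b ⊗ t) (p≈ i) (q≈ i)) (cramerˡ a b c d (u i) (v i))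
  δv : comb p q c a ≈ (δ · v)
  δv i = trans (cong₂ (λ s t → c ⊗ s ⊕ a ⊗ t) (p≈ i) (q≈ i)) (cramerʳ a b c d (u i) (v i))
  by-determinant : Dec (δ ≡ 𝟘) → Span₂ p q u × Span₂ p q v
  by-determinant (no δ≢0) = Span₂-unscale δ≢0 (d , b , ≈-sym δu) , Span₂-unscale δ≢0 (c , a , ≈-sym δv)
  by-determinant (yes δ≡0) = ⊥-elim (independent⇒nonzero ind p≡0)
    where
    a≡0 : a ≡ 𝟘
    a≡0 = proj₂ (ind c a (λ i → trans (δv i) (cong (_⊗ v i) δ≡0)))
    b≡0 : b ≡ 𝟘
    b≡0 = proj₂ (ind d b (λ i → trans (δu i) (cong (_⊗ u i) δ≡0)))
    p≡0 : IsZero p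
    p≡0 i = trans (p≈ i) (cong₂ (λ a b → a ⊗ u i ⊕ b ⊗ v i) a≡0 b≡0)

basis-exchange : ∀ {u v p q} → Span₂ u v p → Span₂ u v q → Independent₂ p q →
  SameSubspace (Span₂ u v) (Span₂ p q)
basis-exchange p∈ q∈ ind = let u∈ , v∈ = independent-spans p∈ q∈ ind in Span₂-same p∈ q∈ u∈ v∈

SameSubspace-sym : ∀ {S T} → SameSubspace S T → SameSubspace T S
SameSubspace-sym S≡T x = proj₂ (S≡T x) , proj₁ (S≡T x)

SameSubspace-trans : ∀ {S T U} → SameSubspace S T → SameSubspace T U → SameSubspace S U
SameSubspace-trans S≡T T≡U x = (λ s → proj₁ (T≡U x) (proj₁ (S≡T x) s)) , (λ u → proj₂ (S≡T x) (proj₂ (T≡U x) u))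

Disjoint-resp : ∀ {S S′ T T′} → SameSubspace S S′ → SameSubspace T T′ → Disjoint S′ T′ → Disjoint S T
Disjoint-resp S≡S′ T≡T′ disjoint x x∈S x∈T = disjoint x (proj₁ (S≡S′ x) x∈S) (proj₁ (T≡T′ x) x∈T)

TrivialMeet : V → V → V → V → Set
TrivialMeet u v u′ v′ = ∀ a b c d → comb u v a b ≈ comb u′ v′ c d → IsZero (comb u v a b)

Span₂-disjoint : ∀ {u v u′ v′} → TrivialMeet u v u′ v′ → Disjoint (Span₂ u v) (Span₂ u′ v′)
Span₂-disjoint trivial x (a , b , x≈) (c , d , x≈′) =
  IsZero-resp (≈-sym x≈) (trivial a b c d (≈-trans (≈-sym x≈) x≈′))

Span₄-mono : ∀ {e f e′ f′ u v u′ v′ x} →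
  Span₂ e f u → Span₂ e f v → Span₂ e′ f′ u′ → Span₂ e′ f′ v′ → Span₄ u v u′ v′ x → Span₄ e f e′ f′ x
Span₄-mono {e} {f} {e′} {f′} {u} {v} {u′} {v′} {x} u∈ v∈ u′∈ v′∈ (a , b , c , d , x≈) =
  let A , B , y≈ = Span₂-⊆ u∈ v∈ (a , b , λ _ → refl)
      C , D , z≈ = Span₂-⊆ u′∈ v′∈ (c , d , λ _ → refl)
  in A , B , C , D , λ i → begin
    x i                                                  ≡⟨ x≈ i ⟩
    ((a ⊗ u i ⊕ b ⊗ v i) ⊕ c ⊗ u′ i) ⊕ d ⊗ v′ i          ≡⟨ ⊕-assoc (a ⊗ u i ⊕ b ⊗ v i) (c ⊗ u′ i) (d ⊗ v′ i) ⟩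
    (a ⊗ u i ⊕ b ⊗ v i) ⊕ (c ⊗ u′ i ⊕ d ⊗ v′ i)          ≡⟨ cong₂ _⊕_ (y≈ i) (z≈ i) ⟩
    (A ⊗ e i ⊕ B ⊗ f i) ⊕ (C ⊗ e′ i ⊕ D ⊗ f′ i)          ≡⟨ sym (⊕-assoc (A ⊗ e i ⊕ B ⊗ f i) (C ⊗ e′ i) (D ⊗ f′ i)) ⟩
    ((A ⊗ e i ⊕ B ⊗ f i) ⊕ C ⊗ e′ i) ⊕ D ⊗ f′ i          ∎
  where open ≡-Reasoning

-- What the proof uses of Good: the requirement that the points differ from the P_j is dropped.
Admissible : Subspace → Set
Admissible S = (∀ x → S x → ¬ IsZero x → SimplexVector x)
             × (∀ j → ∃ λ x → S x × C j x × H j x × ¬ IsZero x)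

Admissible-resp : ∀ {S T} → SameSubspace S T → Admissible S → Admissible T
Admissible-resp S≡T (simplex , meets) =
  (λ x x∈T → simplex x (proj₂ (S≡T x) x∈T)) ,
  (λ j → let x , x∈S , rest = meets j in x , proj₁ (S≡T x) x∈S , rest)

Good⇒Admissible : ∀ {u v} → Good u v → Admissible (Span₂ u v)
Good⇒Admissible ((_ , simplex) , meets) = simplex , λ j →
  let x , x≢0 , point = proj₁ (meets j)
      x∈ , hx , cx = proj₂ (point x) (𝟙 , λ i → sym (⊗-identityˡ (x i)))
  in x , x∈ , cx , hx , x≢0

Admissible₂ : V → V → Set
Admissible₂ u v = (∀ a b → ¬ IsZero (comb u v a b) → SimplexVector (comb u v a b))
                × (∀ j → ∃₂ λ a b → C j (comb u v a b) × H j (comb u v a b) × ¬ IsZero (comb u v a b))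

Admissible₂? : ∀ u v → Dec (Admissible₂ u v)
Admissible₂? u v =
  (∀? λ a → ∀? λ b → ¬? (IsZero? (comb u v a b)) →-dec SimplexVector? (comb u v a b)) ×-dec
  Fin.all? λ j → ∃? λ a → ∃? λ b →
    comb u v a b j ≟ 𝟘 ×-dec dot (hcoef j) (comb u v a b) ≟ 𝟘 ×-dec ¬? (IsZero? (comb u v a b))

Admissible⇒Admissible₂ : ∀ {u v} → Admissible (Span₂ u v) → Admissible₂ u v
Admissible⇒Admissible₂ (simplex , meets) =
  (λ a b → simplex _ (a , b , λ _ → refl)) ,
  λ j → let x , (a , b , x≈) , cx , hx , x≢0 = meets j
        in a , b , C-resp j x≈ cx , H-resp j x≈ hx , λ z → x≢0 (IsZero-resp (≈-sym x≈) z)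

record Echelon : Set where
  constructor echelon
  field x₂ x₃ x₄ y₂ y₃ y₄ : F4

open Echelon

row₁ row₂ : Echelon → V
row₁ E = vec 𝟘 𝟙 (x₂ E) (x₃ E) (x₄ E)
row₂ E = vec 𝟙 𝟘 (y₂ E) (y₃ E) (y₄ E)

⟦_⟧ : Echelon → Subspace
⟦ E ⟧ = Span₂ (row₁ E) (row₂ E)

∀ᴱ? : {P : Echelon → Set} → Decidable P → Dec (∀ E → P E)
∀ᴱ? P? = map′ (λ h E → h (x₂ E) (x₃ E) (x₄ E) (y₂ E) (y₃ E) (y₄ E))
              (λ h a b c d e f → h (echelon a b c d e f))
              (∀? λ a → ∀? λ b → ∀? λ c → ∀? λ d → ∀? λ e → ∀? λ f → P? (echelon a b c d e f))

echelon-independent : ∀ E → Independent₂ (row₁ E) (row₂ E)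
echelon-independent E a b z = trans (sym (pivotˡ a b)) (z 1F) , trans (sym (pivotʳ a b)) (z 0F)

scaled-vec : ∀ c (w : V) {a b} → c ⊗ w 0F ≡ a → c ⊗ w 1F ≡ b →
  (c · w) ≈ vec a b (c ⊗ w 2F) (c ⊗ w 3F) (c ⊗ w 4F)
scaled-vec c w e₀ e₁ 0F = e₀
scaled-vec c w e₀ e₁ 1F = e₁
scaled-vec c w e₀ e₁ 2F = refl
scaled-vec c w e₀ e₁ 3F = refl
scaled-vec c w e₀ e₁ 4F = refl

-- The points of the line on C₁ and C₂ are simplex vectors, so they can be scaled to the two rows.
echelon-basis : ∀ {u v} → Admissible (Span₂ u v) → Σ Echelon λ E → SameSubspace (Span₂ u v) ⟦ E ⟧
echelon-basis {u} {v} (simplex , meets) with meets 0F | meets 1F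
... | p , p∈ , p₀≡0 , _ , p≢0 | q , q∈ , q₁≡0 , _ , q≢0 = E , basis-exchange r₁∈ r₂∈ (echelon-independent E)
  where
  p₁≢0 : p 1F ≢ 𝟘
  p₁≢0 p₁≡0 = Fin.0≢1+n (simplex-unique-zero (simplex p p∈ p≢0) p₀≡0 p₁≡0)
  q₀≢0 : q 0F ≢ 𝟘
  q₀≢0 q₀≡0 = Fin.0≢1+n (simplex-unique-zero (simplex q q∈ q≢0) q₀≡0 q₁≡0)
  s t : F4
  s = p 1F ⁻¹
  t = q 0F ⁻¹
  E : Echelon
  E = echelon (s ⊗ p 2F) (s ⊗ p 3F) (s ⊗ p 4F) (t ⊗ q 2F) (t ⊗ q 3F) (t ⊗ q 4F)
  r₁∈ : Span₂ u v (row₁ E)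
  r₁∈ = Span₂-resp (scaled-vec s p (trans (cong (s ⊗_) p₀≡0) (⊗-zeroʳ s)) (⁻¹-inverseˡ _ p₁≢0))
                   (Span₂-scale s p∈)
  r₂∈ : Span₂ u v (row₂ E)
  r₂∈ = Span₂-resp (scaled-vec t q (⁻¹-inverseˡ _ q₀≢0) (trans (cong (t ⊗_) q₁≡0) (⊗-zeroʳ t)))
                   (Span₂-scale t q∈)

-- basis 1F spans L itself, which is admissible; the other six are L₁, …, L₆.
basis : Fin 7 → Echelon
basis 0F = echelon α  α  𝟙  𝟙  α² 𝟙
basis 1F = echelon 𝟙  𝟙  𝟙  𝟙  α  α²
basis 2F = echelon α² α² 𝟙  α² α  α
basis 3F = echelon 𝟙  α  α  α  α  𝟙
basis 4F = echelon 𝟙  α² α² α² 𝟙  α²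
basis 5F = echelon α² 𝟙  α² 𝟙  𝟙  α
basis 6F = echelon α  𝟙  α  α  α² α²

opaque
  classification : ∀ E → Admissible₂ (row₁ E) (row₂ E) →
    Σ (Fin 7) λ i → row₁ E ≈ row₁ (basis i) × row₂ E ≈ row₂ (basis i)
  classification = from-yes (∀ᴱ? λ E → Admissible₂? (row₁ E) (row₂ E) →-dec
    Fin.any? λ i → row₁ E ≈? row₁ (basis i) ×-dec row₂ E ≈? row₂ (basis i))

line : Fin 7 → Subspace
line i = ⟦ basis i ⟧

plane : Fin 7 → Fin 7 → Subspace
plane i j = Span₄ (row₁ (basis i)) (row₂ (basis i)) (row₁ (basis j)) (row₂ (basis j))

opaque
  bases-meet-trivially : ∀ i j → i ≢ j →
    TrivialMeet (row₁ (basis i)) (row₂ (basis i)) (row₁ (basis j)) (row₂ (basis j))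
  bases-meet-trivially = from-yes (Fin.all? λ i → Fin.all? λ j → ¬? (i Fin.≟ j) →-dec
    ∀? λ a → ∀? λ b → ∀? λ c → ∀? λ d →
      let x = comb (row₁ (basis i)) (row₂ (basis i)) a b
      in x ≈? comb (row₁ (basis j)) (row₂ (basis j)) c d →-dec IsZero? x)

plane? : ∀ i j x → Dec (plane i j x)
plane? i j x = ∃? λ a → ∃? λ b → ∃? λ c → ∃? λ d →
  x ≈? (((a · row₁ (basis i)) +ᵥ (b · row₂ (basis i))) +ᵥ (c · row₁ (basis j)))
         +ᵥ (d · row₂ (basis j))

opaque
  plane-misses-basis : ∀ i j k → i ≢ j → i ≢ k → j ≢ k →
    ¬ (plane i j (row₁ (basis k)) × plane i j (row₂ (basis k)))
  plane-misses-basis = from-yes (Fin.all? λ i → Fin.all? λ j → Fin.all? λ k →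
    ¬? (i Fin.≟ j) →-dec ¬? (i Fin.≟ k) →-dec ¬? (j Fin.≟ k) →-dec
    ¬? (plane? i j (row₁ (basis k)) ×-dec plane? i j (row₂ (basis k))))

lines-disjoint : ∀ {i j} → i ≢ j → Disjoint (line i) (line j)
lines-disjoint {i} {j} i≢j = Span₂-disjoint (bases-meet-trivially i j i≢j)

opaque
  classify : ∀ {u v} → Good u v → Σ (Fin 7) λ i → SameSubspace (Span₂ u v) (line i)
  classify good =
    let admissible = Good⇒Admissible good
        E , uv≡E = echelon-basis admissible
        i , r₁≈ , r₂≈ = classification E (Admissible⇒Admissible₂ (Admissible-resp uv≡E admissible))
    in i , SameSubspace-trans uv≡E (Span₂-cong r₁≈ r₂≈)

distinct-lines : ∀ {S T i j} → SameSubspace S (line i) → SameSubspace T (line j) →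
  ¬ SameSubspace S T → i ≢ j
distinct-lines S≡i T≡j S≢T refl = S≢T (SameSubspace-trans S≡i (SameSubspace-sym T≡j))

plane-avoids-line : ∀ {u₁ v₁ u₂ v₂ u₃ v₃ i j k} → i ≢ j → i ≢ k → j ≢ k →
  SameSubspace (Span₂ u₁ v₁) (line i) → SameSubspace (Span₂ u₂ v₂) (line j) →
  SameSubspace (Span₂ u₃ v₃) (line k) → ¬ (∀ x → Span₂ u₃ v₃ x → Span₄ u₁ v₁ u₂ v₂ x)
plane-avoids-line {u₁} {v₁} {u₂} {v₂} {i = i} {j} {k} i≢j i≢k j≢k L₁≡ L₂≡ L₃≡ L₃⊆ =
  plane-misses-basis i j k i≢j i≢k j≢k (in-plane _ (Span₂-left _ _) , in-plane _ (Span₂-right _ _))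
  where
  in-plane : ∀ x → line k x → plane i j x
  in-plane x x∈ = Span₄-mono (proj₁ (L₁≡ u₁) (Span₂-left u₁ v₁)) (proj₁ (L₁≡ v₁) (Span₂-right u₁ v₁))
                             (proj₁ (L₂≡ u₂) (Span₂-left u₂ v₂)) (proj₁ (L₂≡ v₂) (Span₂-right u₂ v₂))
                             (L₃⊆ x (proj₂ (L₃≡ x) x∈))

lemma4 : (u₁ v₁ u₂ v₂ u₃ v₃ : V) →
    Good u₁ v₁ → Good u₂ v₂ → Good u₃ v₃ →
    ¬ SameSubspace (Span₂ u₁ v₁) (Span₂ u₂ v₂) →
    ¬ SameSubspace (Span₂ u₃ v₃) (Span₂ u₁ v₁) →
    ¬ SameSubspace (Span₂ u₃ v₃) (Span₂ u₂ v₂) →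
    Disjoint (Span₂ u₁ v₁) (Span₂ u₂ v₂)
    × ¬ (∀ x → Span₂ u₃ v₃ x → Span₄ u₁ v₁ u₂ v₂ x)
lemma4 u₁ v₁ u₂ v₂ u₃ v₃ good₁ good₂ good₃ L₁≢L₂ L₃≢L₁ L₃≢L₂
  with classify good₁ | classify good₂ | classify good₃
... | i , L₁≡ | j , L₂≡ | k , L₃≡ =
  Disjoint-resp L₁≡ L₂≡ (lines-disjoint i≢j) , plane-avoids-line {i = i} {j} {k} i≢j i≢k j≢k L₁≡ L₂≡ L₃≡
  where
  i≢j : i ≢ j
  i≢j = distinct-lines L₁≡ L₂≡ L₁≢L₂
  i≢k : i ≢ k
  i≢k i≡k = distinct-lines L₃≡ L₁≡ L₃≢L₁ (sym i≡k)
  j≢k : j ≢ k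
  j≢k j≡k = distinct-lines L₃≡ L₂≡ L₃≢L₂ (sym j≡k)
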